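{- Let $v,k,\ell$ be positive integers. If the complete graph $K_{v+1}$ has a $k$-null $1$-factorisation and $\mathcal S$ is an $\mathrm{STS}(v)$ with a zero-sum $\ell$-flow, then $\mathcal S$ can be embedded into an $\mathrm{STS}(2v+1)$ with a zero-sum $\max(k,\ell)$-flow.
   Context: For a graph $G$ and positive integer $k$, a zero-sum $k$-flow of $G$ is a map $f:E(G)\to\{\pm1,\dots,\pm(k-1)\}$ such that the sum of $f$ over the edges incident with any vertex is $0$. A $1$-factor is a set of pairwise disjoint edges covering all vertices; a $1$-factorisation is a partition of $E(G)$ into $1$-factors. $G$ has a $k$-null $1$-factorisation if there is a zero-sum $k$-flow $f$ of $G$ and a $1$-factorisation of $G$ in which every $1$-factor has weight zero, the weight of an edge set being the sum of the $f$-values of its edges. An $\mathrm{STS}(v)$ is a set $X$ of $v$ points with a set $\mathcal B$ of $3$-subsets (blocks) such that every pair of points lies in exactly one block; a zero-sum $n$-flow of it is a map $f:\mathcal B\to\{\pm1,\dots,\pm(n-1)\}$ with $\sum_{B\ni x}f(B)=0$ for every point $x$. $(X,\mathcal B)$ is embedded in $(Y,\mathcal C)$ if $X\subseteq Y$ and $\mathcal B\subseteq\mathcal C$. -}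

module Defs where

open import Data.Nat using (ℕ; zero; suc; _⊔_) renaming (_<_ to _<ℕ_)
open import Data.Integer using (ℤ; +_; _+_; ∣_∣)
open import Data.Bool using (Bool; true; false; if_then_else_; _∧_; _∨_)
open import Data.Fin using (Fin; zero; suc; _<_)
open import Data.Fin.Properties using (_≟_; _<?_)
open import Data.Product using (Σ; _×_; _,_; proj₁; proj₂; ∃)
open import Data.Sum using (_⊎_)
open import Relation.Nullary using (does; ¬_)
open import Relation.Binary.PropositionalEquality using (_≡_; _≢_)
open import Function.Definitions using (Injective)

Σℤ : ∀ {n} → (Fin n → ℤ) → ℤ
Σℤ {zero}  g = + 0
Σℤ {suc n} g = g zero + Σℤ (λ i → g (suc i))

FlowValue : ℕ → ℤ → Set
FlowValue k z = (z ≢ + 0) × (∣ z ∣ <ℕ k)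

-- A map on the edges of K_n is represented by a function
-- f : Fin n → Fin n → ℤ that is symmetric off the diagonal
-- (the edge {x,y}, x ≠ y, gets value f x y = f y x; diagonal values
-- are irrelevant and never used).

OffDiagSym : ∀ {n} {A : Set} → (Fin n → Fin n → A) → Set
OffDiagSym {n} f = ∀ (x y : Fin n) → x ≢ y → f x y ≡ f y x

incident : ∀ {n} → (Fin n → Fin n → ℤ) → Fin n → Fin n → ℤ
incident f x y = if does (x ≟ y) then + 0 else f x y

IsZeroSumFlowK : (n k : ℕ) → (Fin n → Fin n → ℤ) → Set
IsZeroSumFlowK n k f =
  OffDiagSym f
  × (∀ (x y : Fin n) → x ≢ y → FlowValue k (f x y))
  × (∀ (x : Fin n) → Σℤ (incident f x) ≡ + 0)

-- A 1-factorisation of K_n into m 1-factors: an (off-diagonally symmetric)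
-- edge colouring c with m colours such that every colour class is a
-- 1-factor, i.e. every vertex x lies on exactly one edge of colour i.
IsOneFactorisation : (n m : ℕ) → (Fin n → Fin n → Fin m) → Set
IsOneFactorisation n m c =
  OffDiagSym c
  × (∀ (x : Fin n) (i : Fin m) →
       Σ (Fin n) λ y → (x ≢ y × c x y ≡ i)
         × (∀ (z : Fin n) → x ≢ z → c x z ≡ i → z ≡ y))
  -- each 1-factor is nonempty (parts of a partition)
  × (∀ (i : Fin m) → Σ (Fin n) λ x → Σ (Fin n) λ y → x ≢ y × c x y ≡ i)

factorWeight : ∀ {n m} → (Fin n → Fin n → ℤ) → (Fin n → Fin n → Fin m) → Fin m → ℤ
factorWeight f c i =
  Σℤ (λ x → Σℤ (λ y → if does (x <? y) ∧ does (c x y ≟ i) then f x y else + 0))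

HasNullOneFactorisation : (n k : ℕ) → Set
HasNullOneFactorisation n k =
  Σ (Fin n → Fin n → ℤ) λ f → IsZeroSumFlowK n k f ×
  Σ ℕ λ m → Σ (Fin n → Fin n → Fin m) λ c → IsOneFactorisation n m c ×
  (∀ (i : Fin m) → factorWeight f c i ≡ + 0)

Triple : ℕ → Set
Triple v = Fin v × Fin v × Fin v

_∈T_ : ∀ {v} → Fin v → Triple v → Set
x ∈T (a , p , q) = (x ≡ a) ⊎ ((x ≡ p) ⊎ (x ≡ q))

_∈T?_ : ∀ {v} → Fin v → Triple v → Bool
x ∈T? (a , p , q) = does (x ≟ a) ∨ does (x ≟ p) ∨ does (x ≟ q)

record STS (v : ℕ) : Set where
  field
    b        : ℕ
    blk      : Fin b → Triple v
    distinct : ∀ (i : Fin b) →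
                 (proj₁ (blk i) ≢ proj₁ (proj₂ (blk i)))
               × (proj₁ (blk i) ≢ proj₂ (proj₂ (blk i)))
               × (proj₁ (proj₂ (blk i)) ≢ proj₂ (proj₂ (blk i)))
    pairs    : ∀ (x y : Fin v) → x ≢ y →
                 Σ (Fin b) λ i → (x ∈T blk i × y ∈T blk i)
                   × (∀ (j : Fin b) → x ∈T blk j → y ∈T blk j → j ≡ i)

open STS public

IsSTSFlow : ∀ {v} (S : STS v) (n : ℕ) → (Fin (b S) → ℤ) → Set
IsSTSFlow {v} S n f =
  (∀ (i : Fin (b S)) → FlowValue n (f i))
  × (∀ (x : Fin v) → Σℤ (λ i → if x ∈T? blk S i then f i else + 0) ≡ + 0)

HasSTSFlow : ∀ {v} (S : STS v) (n : ℕ) → Set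
HasSTSFlow S n = Σ (Fin (b S) → ℤ) λ f → IsSTSFlow S n f

EmbeddedIn : ∀ {v w} → STS v → STS w → Set
EmbeddedIn {v} {w} S T =
  Σ (Fin v → Fin w) λ ι → Injective _≡_ _≡_ ι ×
  (∀ (i : Fin (b S)) → Σ (Fin (b T)) λ j →
     ∀ (y : Fin w) →
       (y ∈T blk T j → Σ (Fin v) λ x → x ∈T blk S i × ι x ≡ y)
     × ((Σ (Fin v) λ x → x ∈T blk S i × ι x ≡ y) → y ∈T blk T j))

module Submission where

-- The doubling construction.  Add the v + 1 vertices of K_{v+1} as new points.  A
-- 1-factorisation of K_{v+1} has v colours, which the edges at vertex 0 match with the
-- points of S; an edge pq whose colour is matched with x yields the block {x, p, q}.
-- Together with the blocks of S these form an STS(2v+1).  Give the blocks of S their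
-- flow values and each edge block the value of its edge in the null flow of K_{v+1}:
-- at a new point p the sum is the flow sum of K_{v+1} at p, and at an old point x it is
-- the flow sum of S at x plus the weight of the 1-factor matched with x, all zero.

open import Defs
open import Data.Nat as ℕ using (ℕ; zero; suc; _⊔_; _*_; _<_)
open import Data.Nat.Properties using (+-identityʳ; m<n⇒m<o⊔n; m<n⇒m<n⊔o)
open import Data.Integer using (ℤ; +_; _+_)
import Data.Integer.Properties as ℤ
open import Data.Bool using (Bool; true; false; if_then_else_; _∨_)
open import Data.Bool.Properties using (if-∧; if-cong; ∨-identityʳ)
open import Data.Fin as Fin using (Fin; zero; suc; _↑ˡ_; _↑ʳ_; splitAt; join; punchOut)
open import Data.Fin.Properties
  using (_≟_; _<?_; <-cmp; <-asym; <-irrefl; <⇒≢; suc-injective; ↑ˡ-injective; ↑ʳ-injective;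
         splitAt-↑ˡ; splitAt-↑ʳ; splitAt⁻¹-↑ˡ; splitAt⁻¹-↑ʳ; splitAt-join; join-splitAt;
         punchIn-punchOut)
open import Data.Product as Product using (Σ; ∃; _×_; _,_; proj₁; proj₂; uncurry)
open import Data.Sum as Sum using (_⊎_; inj₁; inj₂; [_,_]′)
open import Data.Empty using (⊥-elim)
open import Function using (_∘_)
open import Function.Definitions using (Injective)
open import Relation.Binary using (tri<; tri≈; tri>)
open import Relation.Nullary using (does; yes; no; ¬_)
open import Relation.Nullary.Decidable using (dec-true; dec-false)
open import Relation.Binary.PropositionalEquality
open import Algebra.Properties.CommutativeMonoid.Sum ℤ.+-0-commutativeMonoid
  using (sum; sum-cong-≗; sum-replicate-zero; ∑-distrib-+)

Σℤ-sum : ∀ {n} (g : Fin n → ℤ) → Σℤ g ≡ sum g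
Σℤ-sum {zero}  g = refl
Σℤ-sum {suc n} g = cong (λ s → g zero + s) (Σℤ-sum (g ∘ suc))

Σℤ-cong : ∀ {n} {g h : Fin n → ℤ} → (∀ i → g i ≡ h i) → Σℤ g ≡ Σℤ h
Σℤ-cong {g = g} {h} g≗h = trans (Σℤ-sum g) (trans (sum-cong-≗ g≗h) (sym (Σℤ-sum h)))

Σℤ-zero : ∀ n → Σℤ {n} (λ _ → + 0) ≡ + 0
Σℤ-zero n = trans (Σℤ-sum {n} _) (sum-replicate-zero n)

Σℤ-distrib-+ : ∀ {n} (g h : Fin n → ℤ) → Σℤ (λ i → g i + h i) ≡ Σℤ g + Σℤ h
Σℤ-distrib-+ g h = begin
  Σℤ (λ i → g i + h i)   ≡⟨ Σℤ-sum (λ i → g i + h i) ⟩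
  sum (λ i → g i + h i)  ≡⟨ ∑-distrib-+ g h ⟩
  sum g + sum h          ≡⟨ cong₂ _+_ (Σℤ-sum g) (Σℤ-sum h) ⟨
  Σℤ g + Σℤ h            ∎
  where open ≡-Reasoning

Σℤ-splitAt : ∀ m {n} (g : Fin m ⊎ Fin n → ℤ) →
  Σℤ (g ∘ splitAt m) ≡ Σℤ (g ∘ inj₁) + Σℤ (g ∘ inj₂)
Σℤ-splitAt zero    g = sym (ℤ.+-identityˡ _)
Σℤ-splitAt (suc m) g = trans (cong (λ s → g (inj₁ zero) + s) (Σℤ-splitAt m (g ∘ Sum.map₁ suc)))
                             (sym (ℤ.+-assoc (g (inj₁ zero)) _ _))

Σℤ-if : ∀ {n} (c : Bool) (g : Fin n → ℤ) →
  Σℤ (λ i → if c then g i else + 0) ≡ (if c then Σℤ g else + 0)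
Σℤ-if     true  g = refl
Σℤ-if {n} false g = Σℤ-zero n

Σℤ-indicator : ∀ {n} (a : Fin n) (g : Fin n → ℤ) →
  Σℤ (λ i → if does (a ≟ i) then g i else + 0) ≡ g a
Σℤ-indicator {suc n} zero    g = trans (cong (λ s → g zero + s) (Σℤ-zero n)) (ℤ.+-identityʳ _)
Σℤ-indicator {suc n} (suc a) g = trans (ℤ.+-identityˡ _) (Σℤ-indicator a (g ∘ suc))

edgeCount : ℕ → ℕ
edgeCount zero    = zero
edgeCount (suc n) = n ℕ.+ edgeCount n

-- The pairs (0, q) come first, followed by the pairs of Fin n shifted by one.
edge : ∀ n → Fin (edgeCount n) → Fin n × Fin n
edge (suc n) = [ (λ j → zero , suc j) , Product.map suc suc ∘ edge n ]′ ∘ splitAt n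

edge-< : ∀ n (e : Fin (edgeCount n)) → proj₁ (edge n e) Fin.< proj₂ (edge n e)
edge-< (suc n) e with splitAt n e
... | inj₁ _ = ℕ.s≤s ℕ.z≤n
... | inj₂ e′ = ℕ.s≤s (edge-< n e′)

edge-surjective : ∀ n {p q : Fin n} → p Fin.< q → ∃ λ e → edge n e ≡ (p , q)
edge-surjective (suc n) {zero} {suc q} _ = q ↑ˡ edgeCount n , edge-↑ˡ
  where
  edge-↑ˡ : edge (suc n) (q ↑ˡ edgeCount n) ≡ (zero , suc q)
  edge-↑ˡ rewrite splitAt-↑ˡ n q (edgeCount n) = refl
edge-surjective (suc n) {suc p} {suc q} (ℕ.s≤s p<q) with edge-surjective n p<q
... | e , edge-e = n ↑ʳ e , edge-↑ʳ
  where
  edge-↑ʳ : edge (suc n) (n ↑ʳ e) ≡ (suc p , suc q)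
  edge-↑ʳ rewrite splitAt-↑ʳ n (edgeCount n) e | edge-e = refl

edge-injective : ∀ n {e e′ : Fin (edgeCount n)} → edge n e ≡ edge n e′ → e ≡ e′
edge-injective (suc n) {e} {e′} eq with splitAt n e in split | splitAt n e′ in split′
... | inj₁ j | inj₁ j′ = begin
  e                   ≡⟨ splitAt⁻¹-↑ˡ split ⟨
  j ↑ˡ edgeCount n    ≡⟨ cong (_↑ˡ edgeCount n) (suc-injective (cong proj₂ eq)) ⟩
  j′ ↑ˡ edgeCount n   ≡⟨ splitAt⁻¹-↑ˡ split′ ⟩
  e′                  ∎
  where open ≡-Reasoning
... | inj₂ k | inj₂ k′ = begin
  e        ≡⟨ splitAt⁻¹-↑ʳ split ⟨
  n ↑ʳ k   ≡⟨ cong (n ↑ʳ_) (edge-injective n (cong₂ _,_ (suc-injective (cong proj₁ eq))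
                                                          (suc-injective (cong proj₂ eq)))) ⟩
  n ↑ʳ k′  ≡⟨ splitAt⁻¹-↑ʳ split′ ⟩
  e′       ∎
  where open ≡-Reasoning
... | inj₁ j | inj₂ k′ with () ← cong proj₁ eq
... | inj₂ k | inj₁ j′ with () ← cong proj₁ eq

_∈E_ : ∀ {n} → Fin n → Fin n × Fin n → Set
a ∈E (p , q) = a ≡ p ⊎ a ≡ q

_∈E?_ : ∀ {n} → Fin n → Fin n × Fin n → Bool
a ∈E? (p , q) = does (a ≟ p) ∨ does (a ≟ q)

edge-cover : ∀ n {a b : Fin n} → a ≢ b → ∃ λ e → a ∈E edge n e × b ∈E edge n e
edge-cover n {a} {b} a≢b with <-cmp a b
... | tri≈ _ a≡b _ = ⊥-elim (a≢b a≡b)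
... | tri< a<b _ _ = let e , edge-e = edge-surjective n a<b in
  e , subst (a ∈E_) (sym edge-e) (inj₁ refl) , subst (b ∈E_) (sym edge-e) (inj₂ refl)
... | tri> _ _ b<a = let e , edge-e = edge-surjective n b<a in
  e , subst (a ∈E_) (sym edge-e) (inj₂ refl) , subst (b ∈E_) (sym edge-e) (inj₁ refl)

∈E-pair : ∀ {n} {a b : Fin n} (pq : Fin n × Fin n) → a ≢ b → a ∈E pq → b ∈E pq →
  pq ≡ (a , b) ⊎ pq ≡ (b , a)
∈E-pair _ a≢b (inj₁ refl) (inj₁ refl) = ⊥-elim (a≢b refl)
∈E-pair _ _   (inj₁ refl) (inj₂ refl) = inj₁ refl
∈E-pair _ _   (inj₂ refl) (inj₁ refl) = inj₂ refl
∈E-pair _ a≢b (inj₂ refl) (inj₂ refl) = ⊥-elim (a≢b refl)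

sorted-pair-unique : ∀ {n} {a b : Fin n} {pq pq′ : Fin n × Fin n} →
  proj₁ pq Fin.< proj₂ pq → proj₁ pq′ Fin.< proj₂ pq′ →
  pq ≡ (a , b) ⊎ pq ≡ (b , a) → pq′ ≡ (a , b) ⊎ pq′ ≡ (b , a) → pq ≡ pq′
sorted-pair-unique _   _    (inj₁ refl) (inj₁ refl) = refl
sorted-pair-unique _   _    (inj₂ refl) (inj₂ refl) = refl
sorted-pair-unique a<b b<a  (inj₁ refl) (inj₂ refl) = ⊥-elim (<-asym a<b b<a)
sorted-pair-unique b<a a<b  (inj₂ refl) (inj₁ refl) = ⊥-elim (<-asym a<b b<a)

edge-unique : ∀ n {a b : Fin n} {e e′ : Fin (edgeCount n)} → a ≢ b →
  a ∈E edge n e → b ∈E edge n e → a ∈E edge n e′ → b ∈E edge n e′ → e ≡ e′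
edge-unique n {e = e} {e′} a≢b a∈e b∈e a∈e′ b∈e′ = edge-injective n
  (sorted-pair-unique (edge-< n e) (edge-< n e′)
    (∈E-pair (edge n e) a≢b a∈e b∈e) (∈E-pair (edge n e′) a≢b a∈e′ b∈e′))

Σℤ-edges : ∀ n (h : Fin n → Fin n → ℤ) →
  Σℤ (λ e → uncurry h (edge n e))
    ≡ Σℤ (λ p → Σℤ (λ q → if does (p <? q) then h p q else + 0))
Σℤ-edges zero    h = refl
Σℤ-edges (suc n) h = begin
  Σℤ (λ e → uncurry h (edge (suc n) e))
    ≡⟨ Σℤ-splitAt n (uncurry h ∘ [ (λ j → zero , suc j) , Product.map suc suc ∘ edge n ]′) ⟩
  Σℤ (h zero ∘ suc) + Σℤ (λ e → uncurry h (Product.map suc suc (edge n e)))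
    ≡⟨ cong (λ s → Σℤ (h zero ∘ suc) + s) (Σℤ-edges n (λ p q → h (suc p) (suc q))) ⟩
  Σℤ (h zero ∘ suc) + Σℤ (λ p → Σℤ (λ q → if does (p <? q) then h (suc p) (suc q) else + 0))
    ≡⟨ cong₂ _+_ (sym (ℤ.+-identityˡ (Σℤ (h zero ∘ suc))))
                 (Σℤ-cong {n} λ _ → sym (ℤ.+-identityˡ _)) ⟩
  Σℤ (λ p → Σℤ (λ q → if does (p <? q) then h p q else + 0)) ∎
  where open ≡-Reasoning

Σℤ-edges-coloured : ∀ n {m} (f : Fin n → Fin n → ℤ) (c : Fin n → Fin n → Fin m) (i : Fin m) →
  Σℤ (λ e → if does (uncurry c (edge n e) ≟ i) then uncurry f (edge n e) else + 0)
    ≡ factorWeight f c i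
Σℤ-edges-coloured n f c i =
  trans (Σℤ-edges n (λ p q → if does (c p q ≟ i) then f p q else + 0))
        (Σℤ-cong {n} λ p → Σℤ-cong {n} λ q → sym (if-∧ (does (p <? q))))

Σℤ-edges-at : ∀ n (f : Fin n → Fin n → ℤ) → OffDiagSym f → (a : Fin n) →
  Σℤ (λ e → if a ∈E? edge n e then uncurry f (edge n e) else + 0)
    ≡ Σℤ (incident f a)
-- Split the edges at a by whether a is their smaller or their larger end; the symmetry
-- of f then glues the two halves into the incident sum.
Σℤ-edges-at n f f-sym a = begin
  Σℤ (λ e → if a ∈E? edge n e then uncurry f (edge n e) else + 0)
    ≡⟨ Σℤ-edges n (λ p q → if a ∈E? (p , q) then f p q else + 0) ⟩
  Σℤ (λ p → Σℤ (λ q → if does (p <? q) then (if a ∈E? (p , q) then f p q else + 0) else + 0))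
    ≡⟨ Σℤ-cong (λ p → trans (Σℤ-cong (split p)) (Σℤ-distrib-+ (atFirst p) (atSecond p))) ⟩
  Σℤ (λ p → Σℤ (atFirst p) + Σℤ (atSecond p))
    ≡⟨ Σℤ-distrib-+ (λ p → Σℤ (atFirst p)) (λ p → Σℤ (atSecond p)) ⟩
  Σℤ (λ p → Σℤ (atFirst p)) + Σℤ (λ p → Σℤ (atSecond p))
    ≡⟨ cong₂ _+_ (trans (Σℤ-cong λ p → Σℤ-if (does (a ≟ p)) (L p))
                        (Σℤ-indicator a (Σℤ ∘ L)))
                 (Σℤ-cong λ p → Σℤ-indicator a (L p)) ⟩
  Σℤ (L a) + Σℤ (λ q → L q a)
    ≡⟨ Σℤ-distrib-+ (L a) (λ q → L q a) ⟨
  Σℤ (λ q → L a q + L q a)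
    ≡⟨ Σℤ-cong both-orientations ⟩
  Σℤ (incident f a) ∎
  where
  open ≡-Reasoning
  L : Fin n → Fin n → ℤ
  L p q = if does (p <? q) then f p q else + 0
  atFirst atSecond : Fin n → Fin n → ℤ
  atFirst  p q = if does (a ≟ p) then L p q else + 0
  atSecond p q = if does (a ≟ q) then L p q else + 0

  split : ∀ p q → (if does (p <? q) then (if a ∈E? (p , q) then f p q else + 0) else + 0)
                  ≡ atFirst p q + atSecond p q
  split p q with a ≟ p | a ≟ q
  ... | yes refl | yes refl rewrite dec-false (a <? a) (<-irrefl refl) = refl
  ... | yes refl | no _ = sym (ℤ.+-identityʳ _)
  ... | no _ | yes refl = sym (ℤ.+-identityˡ _)
  ... | no _ | no _ = if-same-zero (does (p <? q))
    where
    if-same-zero : ∀ b → (if b then + 0 else + 0) ≡ + 0 + + 0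
    if-same-zero true  = refl
    if-same-zero false = refl

  both-orientations : ∀ q → L a q + L q a ≡ incident f a q
  both-orientations q with <-cmp a q
  ... | tri< a<q a≢q _
    rewrite dec-true (a <? q) a<q | dec-false (q <? a) (<-asym a<q) | dec-false (a ≟ q) a≢q
    = ℤ.+-identityʳ _
  ... | tri≈ a≮a refl _
    rewrite dec-false (a <? a) a≮a | dec-true (a ≟ a) refl
    = refl
  ... | tri> a≮q a≢q q<a
    rewrite dec-false (a <? q) a≮q | dec-true (q <? a) q<a | dec-false (a ≟ q) a≢q
    = trans (ℤ.+-identityˡ _) (f-sym q a (a≢q ∘ sym))

does-≟-injective : ∀ {n n′} {f : Fin n → Fin n′} → Injective _≡_ _≡_ f →
  ∀ x y → does (f x ≟ f y) ≡ does (x ≟ y)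
does-≟-injective {f = f} f-inj x y with x ≟ y
... | yes refl = dec-true (f x ≟ f x) refl
... | no x≢y = dec-false (f x ≟ f y) (x≢y ∘ f-inj)

mapT : ∀ {v w} → (Fin v → Fin w) → Triple v → Triple w
mapT f (a , p , q) = f a , f p , f q

∈T-map : ∀ {v w} (f : Fin v → Fin w) {x t} → x ∈T t → f x ∈T mapT f t
∈T-map f = Sum.map (cong f) (Sum.map (cong f) (cong f))

∈T-map⁻ : ∀ {v w} {f : Fin v → Fin w} → Injective _≡_ _≡_ f →
  ∀ {x t} → f x ∈T mapT f t → x ∈T t
∈T-map⁻ f-inj = Sum.map f-inj (Sum.map f-inj f-inj)

∈T-map-image : ∀ {v w} (f : Fin v → Fin w) {y} t →
  y ∈T mapT f t → ∃ λ x → x ∈T t × f x ≡ y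
∈T-map-image f t (inj₁ refl)        = _ , inj₁ refl , refl
∈T-map-image f t (inj₂ (inj₁ refl)) = _ , inj₂ (inj₁ refl) , refl
∈T-map-image f t (inj₂ (inj₂ refl)) = _ , inj₂ (inj₂ refl) , refl

∉T-map : ∀ {v w} {f : Fin v → Fin w} {y} → (∀ x → y ≢ f x) → ∀ {t} → ¬ y ∈T mapT f t
∉T-map y∉f = [ y∉f _ , [ y∉f _ , y∉f _ ]′ ]′

∈T?-map : ∀ {v w} {f : Fin v → Fin w} → Injective _≡_ _≡_ f →
  ∀ x t → f x ∈T? mapT f t ≡ x ∈T? t
∈T?-map f-inj x (a , p , q) =
  cong₂ _∨_ (does-≟-injective f-inj x a)
            (cong₂ _∨_ (does-≟-injective f-inj x p) (does-≟-injective f-inj x q))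

∈T?-map-∉ : ∀ {v w} {f : Fin v → Fin w} {y} → (∀ x → y ≢ f x) →
  ∀ t → y ∈T? mapT f t ≡ false
∈T?-map-∉ {f = f} {y} y∉f (a , p , q)
  rewrite dec-false (y ≟ f a) (y∉f a) | dec-false (y ≟ f p) (y∉f p) | dec-false (y ≟ f q) (y∉f q)
  = refl

Distinct : ∀ {w} → Triple w → Set
Distinct (a , p , q) = a ≢ p × a ≢ q × p ≢ q

UniqueBlock : ∀ {w} {I : Set} → (I → Triple w) → Fin w → Fin w → Set
UniqueBlock {I = I} block x y =
  Σ I λ u → (x ∈T block u × y ∈T block u)
          × (∀ u′ → x ∈T block u′ → y ∈T block u′ → u′ ≡ u)

UniqueBlock-sym : ∀ {w} {I : Set} (block : I → Triple w) {x y} →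
  UniqueBlock block x y → UniqueBlock block y x
UniqueBlock-sym block (u , (x∈u , y∈u) , u-unique) =
  u , (y∈u , x∈u) , λ u′ y∈ x∈ → u-unique u′ x∈ y∈

sumIndexedSTS : ∀ {w} b₁ b₂ (block : Fin b₁ ⊎ Fin b₂ → Triple w) →
  (∀ u → Distinct (block u)) → (∀ x y → x ≢ y → UniqueBlock block x y) → STS w
sumIndexedSTS b₁ b₂ block distinct unique = record
  { b        = b₁ ℕ.+ b₂
  ; blk      = block ∘ splitAt b₁
  ; distinct = distinct ∘ splitAt b₁
  ; pairs    = λ x y x≢y →
      let u , x,y∈u , u-unique = unique x y x≢y in
      join b₁ b₂ u
      , subst (λ u′ → x ∈T block u′ × y ∈T block u′) (sym (splitAt-join b₁ b₂ u)) x,y∈u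
      , λ t x∈t y∈t →
          trans (sym (join-splitAt b₁ b₂ t)) (cong (join b₁ b₂) (u-unique _ x∈t y∈t))
  }

module OneFactorisation {v m} {c : Fin (suc v) → Fin (suc v) → Fin m}
                        (isFactorisation : IsOneFactorisation (suc v) m c) where

  c-sym : OffDiagSym c
  c-sym = proj₁ isFactorisation

  partner : Fin (suc v) → Fin m → Fin (suc v)
  partner x i = proj₁ (proj₁ (proj₂ isFactorisation) x i)

  partner-≢ : ∀ x i → x ≢ partner x i
  partner-≢ x i = proj₁ (proj₁ (proj₂ (proj₁ (proj₂ isFactorisation) x i)))

  partner-colour : ∀ x i → c x (partner x i) ≡ i
  partner-colour x i = proj₂ (proj₁ (proj₂ (proj₁ (proj₂ isFactorisation) x i)))

  partner-unique : ∀ {x z i} → x ≢ z → c x z ≡ i → z ≡ partner x i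
  partner-unique {x} {z} {i} = proj₂ (proj₂ (proj₁ (proj₂ isFactorisation) x i)) z

  colour-∈E : ∀ {a b} (pq : Fin (suc v) × Fin (suc v)) → a ≢ b → a ∈E pq → b ∈E pq →
    uncurry c pq ≡ c a b
  colour-∈E pq a≢b a∈pq b∈pq with ∈E-pair pq a≢b a∈pq b∈pq
  ... | inj₁ refl = refl
  ... | inj₂ refl = c-sym _ _ (a≢b ∘ sym)

  partner-∈E : ∀ {a p q i} → p ≢ q → c p q ≡ i → a ∈E (p , q) → partner a i ∈E (p , q)
  partner-∈E p≢q cpq≡i (inj₁ refl) = inj₂ (sym (partner-unique p≢q cpq≡i))
  partner-∈E p≢q cpq≡i (inj₂ refl) =
    inj₁ (sym (partner-unique (p≢q ∘ sym) (trans (c-sym _ _ (p≢q ∘ sym)) cpq≡i)))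

  colourAt : Fin v → Fin m
  colourAt x = c zero (suc x)

  pointOf : Fin m → Fin v
  pointOf i = punchOut (partner-≢ zero i)

  colourAt-pointOf : ∀ i → colourAt (pointOf i) ≡ i
  colourAt-pointOf i =
    trans (cong (c zero) (punchIn-punchOut (partner-≢ zero i))) (partner-colour zero i)

  pointOf-colourAt : ∀ x → pointOf (colourAt x) ≡ x
  pointOf-colourAt x = suc-injective
    (trans (punchIn-punchOut (partner-≢ zero (colourAt x))) (sym (partner-unique (λ ()) refl)))

  does-pointOf : ∀ x i → does (x ≟ pointOf i) ≡ does (i ≟ colourAt x)
  does-pointOf x i with x ≟ pointOf i | i ≟ colourAt x
  ... | yes _    | yes _    = refl
  ... | no _     | no _     = refl
  ... | yes refl | no i≢    = ⊥-elim (i≢ (sym (colourAt-pointOf i)))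
  ... | no x≢    | yes refl = ⊥-elim (x≢ (sym (pointOf-colourAt x)))

module Doubling {v m} (S : STS v) {c : Fin (suc v) → Fin (suc v) → Fin m}
                (isFactorisation : IsOneFactorisation (suc v) m c) where

  open OneFactorisation isFactorisation

  new : Fin (suc v) → Fin (suc v ℕ.+ v)
  new a = a ↑ˡ v

  old : Fin v → Fin (suc v ℕ.+ v)
  old x = suc v ↑ʳ x

  new-injective : Injective _≡_ _≡_ new
  new-injective = ↑ˡ-injective v _ _

  old-injective : Injective _≡_ _≡_ old
  old-injective = ↑ʳ-injective (suc v) _ _

  new≢old : ∀ a x → new a ≢ old x
  new≢old a x eq
    with () ← trans (sym (splitAt-↑ˡ (suc v) a v))
                    (trans (cong (splitAt (suc v)) eq) (splitAt-↑ʳ (suc v) v x))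

  new-or-old : ∀ X → (∃ λ a → new a ≡ X) ⊎ (∃ λ x → old x ≡ X)
  new-or-old X with splitAt (suc v) X in split
  ... | inj₁ a = inj₁ (a , splitAt⁻¹-↑ˡ split)
  ... | inj₂ x = inj₂ (x , splitAt⁻¹-↑ʳ split)

  edgeBlock : Fin (suc v) × Fin (suc v) → Triple (suc v ℕ.+ v)
  edgeBlock (p , q) = old (pointOf (c p q)) , new p , new q

  Block : Set
  Block = Fin (b S) ⊎ Fin (edgeCount (suc v))

  block : Block → Triple (suc v ℕ.+ v)
  block (inj₁ i) = mapT old (blk S i)
  block (inj₂ e) = edgeBlock (edge (suc v) e)

  old∈edgeBlock : ∀ {x} pq → old x ∈T edgeBlock pq → uncurry c pq ≡ colourAt x
  old∈edgeBlock pq (inj₁ eq) = trans (sym (colourAt-pointOf _)) (cong colourAt (sym (old-injective eq)))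
  old∈edgeBlock pq (inj₂ (inj₁ eq)) = ⊥-elim (new≢old _ _ (sym eq))
  old∈edgeBlock pq (inj₂ (inj₂ eq)) = ⊥-elim (new≢old _ _ (sym eq))

  old∈edgeBlock⁻ : ∀ {x} pq → uncurry c pq ≡ colourAt x → old x ∈T edgeBlock pq
  old∈edgeBlock⁻ pq eq = inj₁ (cong old (trans (sym (pointOf-colourAt _)) (cong pointOf (sym eq))))

  new∈edgeBlock : ∀ {a} pq → new a ∈T edgeBlock pq → a ∈E pq
  new∈edgeBlock pq (inj₁ eq) = ⊥-elim (new≢old _ _ eq)
  new∈edgeBlock pq (inj₂ a∈pq) = Sum.map new-injective new-injective a∈pq

  new∈edgeBlock⁻ : ∀ {a} pq → a ∈E pq → new a ∈T edgeBlock pq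
  new∈edgeBlock⁻ pq = inj₂ ∘ Sum.map (cong new) (cong new)

  old∈?edgeBlock : ∀ x pq → old x ∈T? edgeBlock pq ≡ does (uncurry c pq ≟ colourAt x)
  old∈?edgeBlock x (p , q)
    rewrite does-≟-injective old-injective x (pointOf (c p q))
          | dec-false (old x ≟ new p) (new≢old p x ∘ sym)
          | dec-false (old x ≟ new q) (new≢old q x ∘ sym)
    = trans (∨-identityʳ _) (does-pointOf x (c p q))

  new∈?edgeBlock : ∀ a pq → new a ∈T? edgeBlock pq ≡ a ∈E? pq
  new∈?edgeBlock a (p , q)
    rewrite dec-false (new a ≟ old (pointOf (c p q))) (new≢old a _)
          | does-≟-injective new-injective a p
          | does-≟-injective new-injective a q
    = refl

  block-distinct : ∀ u → Distinct (block u)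
  block-distinct (inj₁ i) =
    let d₁ , d₂ , d₃ = distinct S i
    in d₁ ∘ old-injective , d₂ ∘ old-injective , d₃ ∘ old-injective
  block-distinct (inj₂ e) =
    new≢old _ _ ∘ sym , new≢old _ _ ∘ sym , <⇒≢ (edge-< (suc v) e) ∘ new-injective

  unique-old-old : ∀ x y → x ≢ y → UniqueBlock block (old x) (old y)
  unique-old-old x y x≢y with pairs S x y x≢y
  ... | i , (x∈i , y∈i) , i-unique = inj₁ i , (∈T-map old x∈i , ∈T-map old y∈i) , unique
    where
    unique : ∀ u → old x ∈T block u → old y ∈T block u → u ≡ inj₁ i
    unique (inj₁ i′) x∈ y∈ =
      cong inj₁ (i-unique i′ (∈T-map⁻ old-injective x∈) (∈T-map⁻ old-injective y∈))
    unique (inj₂ e) x∈ y∈ = ⊥-elim (x≢y (begin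
      x                                      ≡⟨ pointOf-colourAt x ⟨
      pointOf (colourAt x)                   ≡⟨ cong pointOf (old∈edgeBlock _ x∈) ⟨
      pointOf (uncurry c (edge (suc v) e))   ≡⟨ cong pointOf (old∈edgeBlock _ y∈) ⟩
      pointOf (colourAt y)                   ≡⟨ pointOf-colourAt y ⟩
      y                                      ∎))
      where open ≡-Reasoning

  unique-new-new : ∀ a a′ → a ≢ a′ → UniqueBlock block (new a) (new a′)
  unique-new-new a a′ a≢a′ with edge-cover (suc v) a≢a′
  ... | e , a∈e , a′∈e = inj₂ e , (new∈edgeBlock⁻ _ a∈e , new∈edgeBlock⁻ _ a′∈e) , unique
    where
    unique : ∀ u → new a ∈T block u → new a′ ∈T block u → u ≡ inj₂ e
    unique (inj₁ i) a∈ _ = ⊥-elim (∉T-map (new≢old a) a∈)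
    unique (inj₂ e′) a∈ a′∈ =
      cong inj₂ (edge-unique (suc v) a≢a′
                  (new∈edgeBlock _ a∈) (new∈edgeBlock _ a′∈) a∈e a′∈e)

  unique-old-new : ∀ x a → UniqueBlock block (old x) (new a)
  unique-old-new x a with edge-cover (suc v) (partner-≢ a (colourAt x))
  ... | e , a∈e , a′∈e = inj₂ e , (old∈edgeBlock⁻ _ colour-e , new∈edgeBlock⁻ _ a∈e) , unique
    where
    a≢a′ : a ≢ partner a (colourAt x)
    a≢a′ = partner-≢ a (colourAt x)
    colour-e : uncurry c (edge (suc v) e) ≡ colourAt x
    colour-e = trans (colour-∈E _ a≢a′ a∈e a′∈e) (partner-colour a (colourAt x))
    unique : ∀ u → old x ∈T block u → new a ∈T block u → u ≡ inj₂ e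
    unique (inj₁ i) _ a∈ = ⊥-elim (∉T-map (new≢old a) a∈)
    unique (inj₂ e′) x∈ a∈ = cong inj₂ (edge-unique (suc v) a≢a′
      (new∈edgeBlock _ a∈)
      (partner-∈E (<⇒≢ (edge-< (suc v) e′)) (old∈edgeBlock _ x∈) (new∈edgeBlock _ a∈))
      a∈e a′∈e)

  unique-block : ∀ X Y → X ≢ Y → UniqueBlock block X Y
  unique-block X Y X≢Y with new-or-old X | new-or-old Y
  ... | inj₁ (a , refl) | inj₁ (a′ , refl) = unique-new-new a a′ (X≢Y ∘ cong new)
  ... | inj₁ (a , refl) | inj₂ (y , refl) = UniqueBlock-sym block (unique-old-new y a)
  ... | inj₂ (x , refl) | inj₁ (a , refl) = unique-old-new x a
  ... | inj₂ (x , refl) | inj₂ (y , refl) = unique-old-old x y (X≢Y ∘ cong old)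

  doubled : STS (suc v ℕ.+ v)
  doubled = sumIndexedSTS (b S) (edgeCount (suc v)) block block-distinct unique-block

  doubled-embeds : EmbeddedIn S doubled
  doubled-embeds = old , old-injective , λ i → join (b S) (edgeCount (suc v)) (inj₁ i) , λ y →
    subst (λ t → (y ∈T t → ∃ λ x → x ∈T blk S i × old x ≡ y)
               × ((∃ λ x → x ∈T blk S i × old x ≡ y) → y ∈T t))
          (cong block (sym (splitAt-join (b S) (edgeCount (suc v)) (inj₁ i))))
          (∈T-map-image old (blk S i) , λ { (x , x∈i , refl) → ∈T-map old x∈i })

  weight : (Fin (b S) → ℤ) → (Fin (suc v) → Fin (suc v) → ℤ) → Block → ℤ
  weight g h (inj₁ i) = g i
  weight g h (inj₂ e) = uncurry h (edge (suc v) e)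

  weightAt : (Block → ℤ) → Fin (suc v ℕ.+ v) → ℤ
  weightAt w X = Σℤ (λ t → if X ∈T? blk doubled t then w (splitAt (b S) t) else + 0)

  weightAt-old : ∀ g h x → weightAt (weight g h) (old x)
    ≡ Σℤ (λ i → if x ∈T? blk S i then g i else + 0) + factorWeight h c (colourAt x)
  weightAt-old g h x =
    trans (Σℤ-splitAt (b S) (λ u → if old x ∈T? block u then weight g h u else + 0))
          (cong₂ _+_ (Σℤ-cong λ i → if-cong (∈T?-map old-injective x (blk S i)))
                     (trans (Σℤ-cong λ e → if-cong (old∈?edgeBlock x (edge (suc v) e)))
                            (Σℤ-edges-coloured (suc v) h c (colourAt x))))

  weightAt-new : ∀ g h → OffDiagSym h → ∀ a → weightAt (weight g h) (new a) ≡ Σℤ (incident h a)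
  weightAt-new g h h-sym a =
    trans (Σℤ-splitAt (b S) (λ u → if new a ∈T? block u then weight g h u else + 0))
          (trans (cong₂ _+_ (trans (Σℤ-cong λ i → if-cong (∈T?-map-∉ (new≢old a) (blk S i)))
                                   (Σℤ-zero (b S)))
                            (trans (Σℤ-cong λ e → if-cong (new∈?edgeBlock a (edge (suc v) e)))
                                   (Σℤ-edges-at (suc v) h h-sym a)))
                 (ℤ.+-identityˡ _))

  doubled-flow : ∀ {k ℓ h} → IsZeroSumFlowK (suc v) k h → (∀ i → factorWeight h c i ≡ + 0) →
    HasSTSFlow S ℓ → HasSTSFlow doubled (k ⊔ ℓ)
  doubled-flow {k} {ℓ} {h} (h-sym , h-values , h-sums) h-null (g , g-values , g-sums) =
    weight g h ∘ splitAt (b S) , values ∘ splitAt (b S) , sums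
    where
    values : ∀ u → FlowValue (k ⊔ ℓ) (weight g h u)
    values (inj₁ i) = Product.map₂ (m<n⇒m<o⊔n k) (g-values i)
    values (inj₂ e) = Product.map₂ (m<n⇒m<n⊔o ℓ) (h-values _ _ (<⇒≢ (edge-< (suc v) e)))
    sums : ∀ X → weightAt (weight g h) X ≡ + 0
    sums X with new-or-old X
    ... | inj₁ (a , refl) = trans (weightAt-new g h h-sym a) (h-sums a)
    ... | inj₂ (x , refl) = trans (weightAt-old g h x) (cong₂ _+_ (g-sums x) (h-null (colourAt x)))

mainTheorem14 : (v k ℓ : ℕ) → 0 < v → 0 < k → 0 < ℓ →
    HasNullOneFactorisation (suc v) k →
    (S : STS v) → HasSTSFlow S ℓ →
    Σ (STS (suc (2 * v))) λ T → EmbeddedIn S T × HasSTSFlow T (k ⊔ ℓ)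
mainTheorem14 v k ℓ _ _ _ (h , h-flow , m , c , isFactorisation , h-null) S S-flow =
  subst (λ w → Σ (STS w) λ T → EmbeddedIn S T × HasSTSFlow T (k ⊔ ℓ))
        (cong (λ n → ℕ.suc (v ℕ.+ n)) (sym (+-identityʳ v)))
        (doubled , doubled-embeds , doubled-flow h-flow h-null S-flow)
  where open Doubling S isFactorisation
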